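{- For every integer $k \geq 0$, the following identity of polynomials in $x$ holds: $$B_k(x) = \sum_{j=0}^{k} \sum_{i=j}^{k} \frac{j+1}{i+1}\, S_1(i+1,j+1)\, S_2(k,i)\, x^j .$$
   Context: $B_k(x)$ denotes the Bernoulli polynomials, defined by the generating function $\frac{t e^{xt}}{e^t-1} = \sum_{k=0}^{\infty} B_k(x) \frac{t^k}{k!}$ for $|t|<2\pi$. $S_1(n,j)$ denotes the signed Stirling numbers of the first kind, defined by $x(x-1)\cdots(x-n+1) = \sum_{j=0}^{n} S_1(n,j) x^j$. $S_2(k,i)$ denotes the Stirling numbers of the second kind (the number of partitions of a $k$-element set into $i$ nonempty blocks, with $S_2(0,0)=1$). The convention $0^0=1$ is used. -}

module Defs where

open import Data.Nat as ℕ using (ℕ; zero; suc)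
open import Data.Nat.Combinatorics using (_C_)
open import Data.Integer as ℤ using (ℤ; +_)
open import Data.Rational using (ℚ; _/_; _+_; _*_; -_; 0ℚ; 1ℚ)
open import Data.List using (List; []; _∷_)

-- sum_{i=a}^{b} f i  (empty if b < a), over ℚ
Σ[_to_] : ℕ → ℕ → (ℕ → ℚ) → ℚ
Σ[ a to b ] f = go (suc b ℕ.∸ a) a
  where
  go : ℕ → ℕ → ℚ
  go zero    i = 0ℚ
  go (suc n) i = f i + go n (suc i)

_^_ : ℚ → ℕ → ℚ
x ^ zero  = 1ℚ
x ^ suc n = x * (x ^ n)

ℕ→ℚ : ℕ → ℚ
ℕ→ℚ n = (+ n) / 1

ℤ→ℚ : ℤ → ℚ
ℤ→ℚ z = z / 1

-- Signed Stirling numbers of the first kind: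
-- x(x-1)...(x-n+1) = Σ_j S₁ n j x^j, i.e. the standard recurrence
-- S₁(n+1,j+1) = S₁(n,j) - n S₁(n,j+1).
S₁ : ℕ → ℕ → ℤ
S₁ zero    zero    = + 1
S₁ zero    (suc j) = + 0
S₁ (suc n) zero    = + 0
S₁ (suc n) (suc j) = S₁ n j ℤ.- (+ n) ℤ.* S₁ n (suc j)

S₂ : ℕ → ℕ → ℕ
S₂ zero    zero    = 1
S₂ zero    (suc i) = 0
S₂ (suc k) zero    = 0
S₂ (suc k) (suc i) = suc i ℕ.* S₂ k (suc i) ℕ.+ S₂ k i

-- Bernoulli numbers B_n = B_n(0) (so B_1 = -1/2), the Taylor coefficients of
-- t/(e^t - 1), characterised by B_0 = 1 and Σ_{m=0}^{n} C(n+1,m) B_m = 0 for n ≥ 1: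
--   B_n = -(1/(n+1)) Σ_{m=0}^{n-1} C(n+1,m) B_m .
-- bernTable n = B_n ∷ B_{n-1} ∷ ... ∷ B_0
bernTable : ℕ → List ℚ
bernTable zero    = 1ℚ ∷ []
bernTable (suc n) = next ∷ tbl
  where
  tbl = bernTable n
  -- the list element at position p (from the front) is B_{n-p}
  acc : ℕ → List ℚ → ℚ
  acc p []       = 0ℚ
  acc p (b ∷ bs) = ℕ→ℚ ((suc (suc n)) C (n ℕ.∸ p)) * b + acc (suc p) bs
  next = - (((+ 1) / suc (suc n)) * acc 0 tbl)

bern : ℕ → ℚ
bern n with bernTable n
... | []    = 0ℚ
... | b ∷ _ = b

-- Bernoulli polynomial B_k(x) = Σ_{m=0}^{k} C(k,m) B_{k-m} x^m,
-- which is the coefficient extraction of t e^{xt}/(e^t-1) = (t/(e^t-1)) e^{xt}.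
bernPoly : ℕ → ℚ → ℚ
bernPoly k x = Σ[ 0 to k ] (λ m → ℕ→ℚ (k C m) * bern (k ℕ.∸ m) * (x ^ m))

module Submission where

-- Let P_k(x) = Σ_i S₂(k, i) (x)_(i+1) / (i + 1), where (x)_n is the falling factorial.
-- Since (x + 1)_(i+1) − (x)_(i+1) = (i + 1) (x)_i and Σ_i S₂(k, i) (x)_i = x^k, we get
-- P_k(x + 1) − P_k(x) = x^k, while B_(k+1)(x + 1) − B_(k+1)(x) = (k + 1) x^k.  So
-- (k + 1) P_k − B_(k+1) is invariant under x ↦ x + 1, hence constant, and comparing the
-- coefficients of x^(j+1) gives (j + 1) [x^(j+1)] P_k = C(k, j) B_(k−j), which is the
-- coefficient of x^j on either side of the identity.

open import Defs
open import Data.Nat as ℕ using (ℕ; zero; suc; _≤_; _<_; z≤n; s≤s; _!)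
import Data.Nat.Properties as ℕₚ
open import Data.Nat.Combinatorics
  using (_C_; k>n⇒nCk≡0; nCn≡1; nC1≡n; nCk≡nC[n∸k]; nCk≡n!/k![n-k]!; k![n∸k]!∣n!; nCk+nC[k+1]≡[n+1]C[k+1])
open import Data.Nat.DivMod using (m/n*n≡m)
open import Data.Nat.Tactic.RingSolver using () renaming (solve to solve-ℕ; solve-∀ to solve-∀-ℕ)
open import Data.Integer as ℤ using (ℤ; +_)
import Data.Integer.Properties as ℤₚ
open import Data.Integer.Tactic.RingSolver using (solve; solve-∀)
open import Data.Rational using (ℚ; _/_; _+_; _*_; _-_; -_; 0ℚ; 1ℚ; toℚᵘ)
import Data.Rational.Properties as ℚₚ
open import Data.Rational.Solver using (module +-*-Solver)
open import Data.Rational.Unnormalised as ℚᵘ using (mkℚᵘ; *≡*)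
import Data.Rational.Unnormalised.Properties as ℚᵘₚ
open import Data.List using (List; []; _∷_)
open import Relation.Binary.PropositionalEquality
open import Relation.Nullary using (yes; no)
open import Algebra.Properties.Group ℚₚ.+-0-group using (identityʳ-unique)

open +-*-Solver using (_:+_; _:*_; _:-_; _:=_; :-_; con) renaming (solve to solveℚ)

≃ᵘ⇒ℤ→ℚ≡ : ∀ z {q} → mkℚᵘ z 0 ℚᵘ.≃ toℚᵘ q → ℤ→ℚ z ≡ q
≃ᵘ⇒ℤ→ℚ≡ z eq = ℚₚ.toℚᵘ-injective (ℚᵘₚ.≃-trans (ℚₚ.toℚᵘ-fromℚᵘ (mkℚᵘ z 0)) eq)

ℤ→ℚ-homo-+ : ∀ a b → ℤ→ℚ (a ℤ.+ b) ≡ ℤ→ℚ a + ℤ→ℚ b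
ℤ→ℚ-homo-+ a b = ≃ᵘ⇒ℤ→ℚ≡ (a ℤ.+ b) (ℚᵘₚ.≃-trans (*≡* numerators) (ℚᵘₚ.≃-sym (ℚᵘₚ.≃-trans
  (ℚₚ.toℚᵘ-homo-+ (ℤ→ℚ a) (ℤ→ℚ b))
  (ℚᵘₚ.+-cong (ℚₚ.toℚᵘ-fromℚᵘ (mkℚᵘ a 0)) (ℚₚ.toℚᵘ-fromℚᵘ (mkℚᵘ b 0))))))
  where
  numerators : (a ℤ.+ b) ℤ.* + 1 ≡ (a ℤ.* + 1 ℤ.+ b ℤ.* + 1) ℤ.* + 1
  numerators = solve (a ∷ b ∷ [])

ℤ→ℚ-homo-* : ∀ a b → ℤ→ℚ (a ℤ.* b) ≡ ℤ→ℚ a * ℤ→ℚ b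
ℤ→ℚ-homo-* a b = ≃ᵘ⇒ℤ→ℚ≡ (a ℤ.* b) (ℚᵘₚ.≃-sym (ℚᵘₚ.≃-trans
  (ℚₚ.toℚᵘ-homo-* (ℤ→ℚ a) (ℤ→ℚ b))
  (ℚᵘₚ.*-cong (ℚₚ.toℚᵘ-fromℚᵘ (mkℚᵘ a 0)) (ℚₚ.toℚᵘ-fromℚᵘ (mkℚᵘ b 0)))))

ℤ→ℚ-homo‿- : ∀ a → ℤ→ℚ (ℤ.- a) ≡ - ℤ→ℚ a
ℤ→ℚ-homo‿- a = ≃ᵘ⇒ℤ→ℚ≡ (ℤ.- a) (ℚᵘₚ.≃-sym (ℚᵘₚ.≃-trans
  (ℚₚ.toℚᵘ-homo‿- (ℤ→ℚ a)) (ℚᵘₚ.-‿cong (ℚₚ.toℚᵘ-fromℚᵘ (mkℚᵘ a 0)))))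

ℤ→ℚ-homo-- : ∀ a b → ℤ→ℚ (a ℤ.- b) ≡ ℤ→ℚ a - ℤ→ℚ b
ℤ→ℚ-homo-- a b = trans (ℤ→ℚ-homo-+ a (ℤ.- b)) (cong (_+_ (ℤ→ℚ a)) (ℤ→ℚ-homo‿- b))

ℕ→ℚ-homo-+ : ∀ a b → ℕ→ℚ (a ℕ.+ b) ≡ ℕ→ℚ a + ℕ→ℚ b
ℕ→ℚ-homo-+ a b = trans (cong ℤ→ℚ (ℤₚ.pos-+ a b)) (ℤ→ℚ-homo-+ (+ a) (+ b))

ℕ→ℚ-homo-* : ∀ a b → ℕ→ℚ (a ℕ.* b) ≡ ℕ→ℚ a * ℕ→ℚ b
ℕ→ℚ-homo-* a b = trans (cong ℤ→ℚ (ℤₚ.pos-* a b)) (ℤ→ℚ-homo-* (+ a) (+ b))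

1/suc : ℕ → ℚ
1/suc d = + 1 / suc d

1/suc-inverseˡ : ∀ d → 1/suc d * ℕ→ℚ (suc d) ≡ 1ℚ
1/suc-inverseˡ d = ℚₚ.toℚᵘ-injective (ℚᵘₚ.≃-trans
  (ℚₚ.toℚᵘ-homo-* (1/suc d) (ℕ→ℚ (suc d)))
  (ℚᵘₚ.≃-trans (ℚᵘₚ.*-cong (ℚₚ.toℚᵘ-fromℚᵘ (mkℚᵘ (+ 1) d)) (ℚₚ.toℚᵘ-fromℚᵘ (mkℚᵘ (+ suc d) 0)))
  (*≡* (cong (λ n → + suc n) (solve-ℕ (d ∷ []))))))

/suc≡*1/suc : ∀ a d → + a / suc d ≡ ℕ→ℚ a * 1/suc d
/suc≡*1/suc a d = ℚₚ.toℚᵘ-injective (ℚᵘₚ.≃-trans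
  (ℚₚ.toℚᵘ-fromℚᵘ (mkℚᵘ (+ a) d))
  (ℚᵘₚ.≃-sym (ℚᵘₚ.≃-trans (ℚₚ.toℚᵘ-homo-* (ℕ→ℚ a) (1/suc d))
  (ℚᵘₚ.≃-trans (ℚᵘₚ.*-cong (ℚₚ.toℚᵘ-fromℚᵘ (mkℚᵘ (+ a) 0)) (ℚₚ.toℚᵘ-fromℚᵘ (mkℚᵘ (+ 1) d)))
  (*≡* (numerators (+ a) (+ suc d)))))))
  where
  numerators : ∀ x y → (x ℤ.* + 1) ℤ.* y ≡ x ℤ.* (+ 1 ℤ.* y)
  numerators = solve-∀

ℕ→ℚ-suc-cancelˡ : ∀ d {p q} → ℕ→ℚ (suc d) * p ≡ ℕ→ℚ (suc d) * q → p ≡ q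
ℕ→ℚ-suc-cancelˡ d {p} {q} eq = begin
  p                             ≡⟨ ℚₚ.*-identityˡ p ⟨
  1ℚ * p                        ≡⟨ cong (_* p) (1/suc-inverseˡ d) ⟨
  1/suc d * ℕ→ℚ (suc d) * p     ≡⟨ ℚₚ.*-assoc (1/suc d) _ p ⟩
  1/suc d * (ℕ→ℚ (suc d) * p)   ≡⟨ cong (1/suc d *_) eq ⟩
  1/suc d * (ℕ→ℚ (suc d) * q)   ≡⟨ ℚₚ.*-assoc (1/suc d) _ q ⟨
  1/suc d * ℕ→ℚ (suc d) * q     ≡⟨ cong (_* q) (1/suc-inverseˡ d) ⟩
  1ℚ * q                        ≡⟨ ℚₚ.*-identityˡ q ⟩
  q                             ∎
  where open ≡-Reasoning

-- Finite sums

sum : ℕ → (ℕ → ℚ) → ℚ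
sum zero    f = 0ℚ
sum (suc n) f = f 0 + sum n (λ i → f (suc i))

sum-cong : ∀ n {f g : ℕ → ℚ} → (∀ i → i < n → f i ≡ g i) → sum n f ≡ sum n g
sum-cong zero    eq = refl
sum-cong (suc n) eq = cong₂ _+_ (eq 0 (s≤s z≤n)) (sum-cong n (λ i i<n → eq (suc i) (s≤s i<n)))

sum-zeros : ∀ n (f : ℕ → ℚ) → (∀ i → i < n → f i ≡ 0ℚ) → sum n f ≡ 0ℚ
sum-zeros zero    f eq = refl
sum-zeros (suc n) f eq = begin
  f 0 + sum n (λ i → f (suc i))
    ≡⟨ cong₂ _+_ (eq 0 (s≤s z≤n)) (sum-zeros n _ (λ i i<n → eq (suc i) (s≤s i<n))) ⟩
  0ℚ + 0ℚ
    ≡⟨⟩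
  0ℚ ∎
  where open ≡-Reasoning

sum-+ : ∀ n (f g : ℕ → ℚ) → sum n (λ i → f i + g i) ≡ sum n f + sum n g
sum-+ zero    f g = refl
sum-+ (suc n) f g = trans (cong (_+_ (f 0 + g 0)) (sum-+ n _ _))
  (solveℚ 4 (λ a b c d → (a :+ b) :+ (c :+ d) := (a :+ c) :+ (b :+ d)) refl
    (f 0) (g 0) (sum n (λ i → f (suc i))) (sum n (λ i → g (suc i))))

sum-*ˡ : ∀ n c (f : ℕ → ℚ) → sum n (λ i → c * f i) ≡ c * sum n f
sum-*ˡ zero    c f = sym (ℚₚ.*-zeroʳ c)
sum-*ˡ (suc n) c f = trans (cong (_+_ (c * f 0)) (sum-*ˡ n c _)) (sym (ℚₚ.*-distribˡ-+ c (f 0) _))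

sum-snoc : ∀ n (f : ℕ → ℚ) → sum (suc n) f ≡ sum n f + f n
sum-snoc zero    f = trans (ℚₚ.+-identityʳ (f 0)) (sym (ℚₚ.+-identityˡ (f 0)))
sum-snoc (suc n) f = trans (cong (_+_ (f 0)) (sum-snoc n (λ i → f (suc i)))) (sym (ℚₚ.+-assoc (f 0) _ _))

sum-split : ∀ m n (f : ℕ → ℚ) → sum (m ℕ.+ n) f ≡ sum m f + sum n (λ r → f (m ℕ.+ r))
sum-split zero    n f = sym (ℚₚ.+-identityˡ (sum n f))
sum-split (suc m) n f =
  trans (cong (_+_ (f 0)) (sum-split m n (λ i → f (suc i)))) (sym (ℚₚ.+-assoc (f 0) _ _))

sum-extendʳ : ∀ {n N} (f : ℕ → ℚ) → n ≤ N → (∀ i → n ≤ i → f i ≡ 0ℚ) → sum N f ≡ sum n f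
sum-extendʳ {n} {N} f n≤N vanish = begin
  sum N f
    ≡⟨ cong (λ M → sum M f) (ℕₚ.m+[n∸m]≡n n≤N) ⟨
  sum (n ℕ.+ (N ℕ.∸ n)) f
    ≡⟨ sum-split n (N ℕ.∸ n) f ⟩
  sum n f + sum (N ℕ.∸ n) (λ r → f (n ℕ.+ r))
    ≡⟨ cong (_+_ (sum n f)) (sum-zeros (N ℕ.∸ n) _ (λ r _ → vanish (n ℕ.+ r) (ℕₚ.m≤m+n n r))) ⟩
  sum n f + 0ℚ
    ≡⟨ ℚₚ.+-identityʳ (sum n f) ⟩
  sum n f ∎
  where open ≡-Reasoning

sum-swap : ∀ m n (f : ℕ → ℕ → ℚ) → sum m (λ i → sum n (λ j → f i j)) ≡ sum n (λ j → sum m (λ i → f i j))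
sum-swap zero    n f = sym (sum-zeros n _ (λ _ _ → refl))
sum-swap (suc m) n f = trans (cong (_+_ (sum n (f 0))) (sum-swap m n (λ i → f (suc i))))
  (sym (sum-+ n (f 0) (λ j → sum m (λ i → f (suc i) j))))

sum-telescope : ∀ n (a : ℕ → ℚ) → sum n (λ i → a (suc i) - a i) ≡ a n - a 0
sum-telescope zero    a = sym (ℚₚ.+-inverseʳ (a 0))
sum-telescope (suc n) a = begin
  sum (suc n) (λ i → a (suc i) - a i)   ≡⟨ sum-snoc n _ ⟩
  sum n (λ i → a (suc i) - a i) + (a (suc n) - a n)
    ≡⟨ cong (_+ (a (suc n) - a n)) (sum-telescope n a) ⟩
  (a n - a 0) + (a (suc n) - a n)
    ≡⟨ solveℚ 3 (λ x y z → (x :- y) :+ (z :- x) := z :- y) refl (a n) (a 0) (a (suc n)) ⟩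
  a (suc n) - a 0                       ∎
  where open ≡-Reasoning

sum-reverse : ∀ n (f : ℕ → ℚ) → sum (suc n) f ≡ sum (suc n) (λ r → f (n ℕ.∸ r))
sum-reverse zero    f = refl
sum-reverse (suc n) f = begin
  f 0 + sum (suc n) (λ i → f (suc i))
    ≡⟨ cong (_+_ (f 0)) (sum-reverse n (λ i → f (suc i))) ⟩
  f 0 + sum (suc n) (λ r → f (suc (n ℕ.∸ r)))
    ≡⟨ cong (_+_ (f 0)) (sum-cong (suc n) (λ r r≤n → cong f (ℕₚ.+-∸-assoc 1 (ℕₚ.≤-pred r≤n)))) ⟨
  f 0 + sum (suc n) (λ r → f (suc n ℕ.∸ r))
    ≡⟨ ℚₚ.+-comm (f 0) _ ⟩
  sum (suc n) (λ r → f (suc n ℕ.∸ r)) + f 0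
    ≡⟨ cong (λ i → sum (suc n) (λ r → f (suc n ℕ.∸ r)) + f i) (ℕₚ.n∸n≡0 (suc n)) ⟨
  sum (suc n) (λ r → f (suc n ℕ.∸ r)) + f (suc n ℕ.∸ suc n) ≡⟨ sum-snoc (suc n) (λ r → f (suc n ℕ.∸ r)) ⟨
  sum (suc (suc n)) (λ r → f (suc n ℕ.∸ r))          ∎
  where open ≡-Reasoning

Σ-unfold : ∀ {a b} f → a ≤ b → Σ[ a to b ] f ≡ f a + Σ[ suc a to b ] f
Σ-unfold {a} f a≤b rewrite ℕₚ.+-∸-assoc 1 a≤b = refl

Σ-singleton : ∀ a f → Σ[ a to a ] f ≡ f a + 0ℚ
Σ-singleton a f rewrite ℕₚ.m+n∸n≡m 1 a = refl

Σ≡sum-shifted : ∀ n a f → Σ[ a to n ℕ.+ a ] f ≡ sum (suc n) (λ t → f (t ℕ.+ a))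
Σ≡sum-shifted zero    a f = Σ-singleton a f
Σ≡sum-shifted (suc n) a f = begin
  Σ[ a to suc n ℕ.+ a ] f
    ≡⟨ Σ-unfold f (ℕₚ.m≤n+m a (suc n)) ⟩
  f a + Σ[ suc a to suc (n ℕ.+ a) ] f
    ≡⟨ cong (λ b → f a + Σ[ suc a to b ] f) (ℕₚ.+-suc n a) ⟨
  f a + Σ[ suc a to n ℕ.+ suc a ] f
    ≡⟨ cong (_+_ (f a)) (Σ≡sum-shifted n (suc a) f) ⟩
  f a + sum (suc n) (λ t → f (t ℕ.+ suc a))
    ≡⟨ cong (_+_ (f a)) (sum-cong (suc n) (λ t _ → cong f (ℕₚ.+-suc t a))) ⟩
  f a + sum (suc n) (λ t → f (suc t ℕ.+ a)) ∎
  where open ≡-Reasoning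

Σ≡sum : ∀ j k f → j ≤ k → (∀ i → i < j → f i ≡ 0ℚ) → Σ[ j to k ] f ≡ sum (suc k) f
Σ≡sum j k f j≤k vanish = begin
  Σ[ j to k ] f
    ≡⟨ cong (λ b → Σ[ j to b ] f) (ℕₚ.m∸n+n≡m j≤k) ⟨
  Σ[ j to (k ℕ.∸ j) ℕ.+ j ] f
    ≡⟨ Σ≡sum-shifted (k ℕ.∸ j) j f ⟩
  sum (suc (k ℕ.∸ j)) (λ t → f (t ℕ.+ j))
    ≡⟨ sum-cong (suc (k ℕ.∸ j)) (λ t _ → cong f (ℕₚ.+-comm t j)) ⟩
  sum (suc (k ℕ.∸ j)) (λ t → f (j ℕ.+ t))
    ≡⟨ ℚₚ.+-identityˡ _ ⟨
  0ℚ + sum (suc (k ℕ.∸ j)) (λ t → f (j ℕ.+ t))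
    ≡⟨ cong (_+ sum (suc (k ℕ.∸ j)) (λ t → f (j ℕ.+ t))) (sum-zeros j f vanish) ⟨
  sum j f + sum (suc (k ℕ.∸ j)) (λ t → f (j ℕ.+ t)) ≡⟨ sum-split j (suc (k ℕ.∸ j)) f ⟨
  sum (j ℕ.+ suc (k ℕ.∸ j)) f
    ≡⟨ cong (λ n → sum n f) (trans (ℕₚ.+-suc j (k ℕ.∸ j)) (cong suc (ℕₚ.m+[n∸m]≡n j≤k))) ⟩
  sum (suc k) f ∎
  where open ≡-Reasoning

nCk*[k!*[n∸k]!]≡n! : ∀ {n k} → k ≤ n → (n C k) ℕ.* (k ! ℕ.* (n ℕ.∸ k) !) ≡ n !
nCk*[k!*[n∸k]!]≡n! {n} {k} k≤n = trans
  (cong (ℕ._* (k ! ℕ.* (n ℕ.∸ k) !)) (nCk≡n!/k![n-k]! k≤n))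
  (m/n*n≡m (k![n∸k]!∣n! k≤n))
  where instance _ = k ℕₚ.!* (n ℕ.∸ k) !≢0

nCl*lCm≡nCm*[n∸m]C[l∸m] : ∀ {n l m} → m ≤ l → l ≤ n →
                          (n C l) ℕ.* (l C m) ≡ (n C m) ℕ.* ((n ℕ.∸ m) C (l ℕ.∸ m))
nCl*lCm≡nCm*[n∸m]C[l∸m] {n} {l} {m} m≤l l≤n =
  ℕₚ.*-cancelʳ-≡ _ _ (m ! ℕ.* (r ! ℕ.* s !)) {{ℕₚ.m*n≢0 (m !) _ {{m ℕₚ.!≢0}} {{r ℕₚ.!* s !≢0}}}}
    (trans via-l (sym via-m))
  where
  open ≡-Reasoning
  r s : ℕ
  r = l ℕ.∸ m
  s = n ℕ.∸ l
  regroup-l : ∀ a b x y z → a ℕ.* b ℕ.* (x ℕ.* (y ℕ.* z)) ≡ a ℕ.* (b ℕ.* (x ℕ.* y)) ℕ.* z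
  regroup-l = solve-∀-ℕ
  regroup-m : ∀ a b x y z → a ℕ.* b ℕ.* (x ℕ.* (y ℕ.* z)) ≡ a ℕ.* (x ℕ.* (b ℕ.* (y ℕ.* z)))
  regroup-m = solve-∀-ℕ
  [n∸m]∸r≡s : (n ℕ.∸ m) ℕ.∸ r ≡ s
  [n∸m]∸r≡s = trans (ℕₚ.∸-+-assoc n m r) (cong (n ℕ.∸_) (ℕₚ.m+[n∸m]≡n m≤l))
  via-l : (n C l) ℕ.* (l C m) ℕ.* (m ! ℕ.* (r ! ℕ.* s !)) ≡ n !
  via-l = begin
    (n C l) ℕ.* (l C m) ℕ.* (m ! ℕ.* (r ! ℕ.* s !))
      ≡⟨ regroup-l (n C l) (l C m) (m !) (r !) (s !) ⟩
    (n C l) ℕ.* ((l C m) ℕ.* (m ! ℕ.* r !)) ℕ.* s !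
      ≡⟨ cong (λ w → (n C l) ℕ.* w ℕ.* s !) (nCk*[k!*[n∸k]!]≡n! m≤l) ⟩
    (n C l) ℕ.* l ! ℕ.* s !
      ≡⟨ ℕₚ.*-assoc (n C l) (l !) (s !) ⟩
    (n C l) ℕ.* (l ! ℕ.* s !)
      ≡⟨ nCk*[k!*[n∸k]!]≡n! l≤n ⟩
    n ! ∎
  via-m : (n C m) ℕ.* ((n ℕ.∸ m) C r) ℕ.* (m ! ℕ.* (r ! ℕ.* s !)) ≡ n !
  via-m = begin
    (n C m) ℕ.* ((n ℕ.∸ m) C r) ℕ.* (m ! ℕ.* (r ! ℕ.* s !))
      ≡⟨ regroup-m (n C m) ((n ℕ.∸ m) C r) (m !) (r !) (s !) ⟩
    (n C m) ℕ.* (m ! ℕ.* (((n ℕ.∸ m) C r) ℕ.* (r ! ℕ.* s !)))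
      ≡⟨ cong (λ w → (n C m) ℕ.* (m ! ℕ.* (((n ℕ.∸ m) C r) ℕ.* (r ! ℕ.* w !)))) [n∸m]∸r≡s ⟨
    (n C m) ℕ.* (m ! ℕ.* (((n ℕ.∸ m) C r) ℕ.* (r ! ℕ.* ((n ℕ.∸ m) ℕ.∸ r) !)))
      ≡⟨ cong (λ w → (n C m) ℕ.* (m ! ℕ.* w)) (nCk*[k!*[n∸k]!]≡n! (ℕₚ.∸-monoˡ-≤ m l≤n)) ⟩
    (n C m) ℕ.* (m ! ℕ.* (n ℕ.∸ m) !)
      ≡⟨ nCk*[k!*[n∸k]!]≡n! (ℕₚ.≤-trans m≤l l≤n) ⟩
    n ! ∎

[1+k]*[1+n]C[1+k]≡[1+n]*nCk : ∀ n k → suc k ℕ.* (suc n C suc k) ≡ suc n ℕ.* (n C k)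
[1+k]*[1+n]C[1+k]≡[1+n]*nCk n k with k ℕ.≤? n
... | no k≰n = begin
  suc k ℕ.* (suc n C suc k)   ≡⟨ cong (suc k ℕ.*_) (k>n⇒nCk≡0 (s≤s (ℕₚ.≰⇒> k≰n))) ⟩
  suc k ℕ.* 0                 ≡⟨ ℕₚ.*-zeroʳ (suc k) ⟩
  0                           ≡⟨ ℕₚ.*-zeroʳ (suc n) ⟨
  suc n ℕ.* 0                 ≡⟨ cong (suc n ℕ.*_) (k>n⇒nCk≡0 (ℕₚ.≰⇒> k≰n)) ⟨
  suc n ℕ.* (n C k)           ∎
  where open ≡-Reasoning
... | yes k≤n = ℕₚ.*-cancelʳ-≡ _ _ (k ! ℕ.* (n ℕ.∸ k) !) {{k ℕₚ.!* (n ℕ.∸ k) !≢0}}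
  (trans (trans (regroup (suc k) (suc n C suc k) (k !) ((n ℕ.∸ k) !)) (nCk*[k!*[n∸k]!]≡n! (s≤s k≤n)))
         (sym (trans (ℕₚ.*-assoc (suc n) (n C k) _) (cong (suc n ℕ.*_) (nCk*[k!*[n∸k]!]≡n! k≤n)))))
  where
  regroup : ∀ a b x y → a ℕ.* b ℕ.* (x ℕ.* y) ≡ b ℕ.* ((a ℕ.* x) ℕ.* y)
  regroup = solve-∀-ℕ

[1+n]Cn≡1+n : ∀ n → suc n C n ≡ suc n
[1+n]Cn≡1+n n = begin
  suc n C n              ≡⟨ nCk≡nC[n∸k] (ℕₚ.n≤1+n n) ⟩
  suc n C (suc n ℕ.∸ n)  ≡⟨ cong (suc n C_) (ℕₚ.m+n∸n≡m 1 n) ⟩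
  suc n C 1              ≡⟨ nC1≡n (suc n) ⟩
  suc n                  ∎
  where open ≡-Reasoning

k>n⇒nCk*q≡0 : ∀ {n k} q → n < k → ℕ→ℚ (n C k) * q ≡ 0ℚ
k>n⇒nCk*q≡0 q n<k = trans (cong (λ c → ℕ→ℚ c * q) (k>n⇒nCk≡0 n<k)) (ℚₚ.*-zeroˡ q)

-- Polynomials as coefficient sequences

DegreeBelow : ℕ → (ℕ → ℚ) → Set
DegreeBelow n p = ∀ l → n ≤ l → p l ≡ 0ℚ

-- The coefficients of p(x + 1), for p of degree below n.
shift : ℕ → (ℕ → ℚ) → ℕ → ℚ
shift n p m = sum n (λ l → ℕ→ℚ (l C m) * p l)

mulX : (ℕ → ℚ) → ℕ → ℚ
mulX p zero    = 0ℚ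
mulX p (suc m) = p m

monomial : ℕ → ℕ → ℚ
monomial zero    zero    = 1ℚ
monomial zero    (suc m) = 0ℚ
monomial (suc k) zero    = 0ℚ
monomial (suc k) (suc m) = monomial k m

mulX-cong : ∀ {p q} → (∀ l → p l ≡ q l) → ∀ m → mulX p m ≡ mulX q m
mulX-cong eq zero    = refl
mulX-cong eq (suc m) = eq m

*-monomial : ∀ (f : ℕ → ℚ) k m → f k * monomial k m ≡ f m * monomial k m
*-monomial f zero    zero    = refl
*-monomial f zero    (suc m) = trans (ℚₚ.*-zeroʳ (f 0)) (sym (ℚₚ.*-zeroʳ (f (suc m))))
*-monomial f (suc k) zero    = trans (ℚₚ.*-zeroʳ (f (suc k))) (sym (ℚₚ.*-zeroʳ (f 0)))
*-monomial f (suc k) (suc m) = *-monomial (λ i → f (suc i)) k m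

shift-extend : ∀ {n N p} → DegreeBelow n p → n ≤ N → ∀ m → shift N p m ≡ shift n p m
shift-extend deg n≤N m = sum-extendʳ _ n≤N (λ l n≤l →
  trans (cong (ℕ→ℚ (l C m) *_) (deg l n≤l)) (ℚₚ.*-zeroʳ (ℕ→ℚ (l C m))))

shift-linear : ∀ n a b p q m →
               shift n (λ l → a * p l - b * q l) m ≡ a * shift n p m - b * shift n q m
shift-linear n a b p q m = begin
  sum n (λ l → ℕ→ℚ (l C m) * (a * p l - b * q l))
    ≡⟨ sum-cong n (λ l _ → distribute (ℕ→ℚ (l C m)) (p l) (q l)) ⟩
  sum n (λ l → a * (ℕ→ℚ (l C m) * p l) + (- b) * (ℕ→ℚ (l C m) * q l))
    ≡⟨ sum-+ n (λ l → a * (ℕ→ℚ (l C m) * p l)) (λ l → (- b) * (ℕ→ℚ (l C m) * q l)) ⟩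
  sum n (λ l → a * (ℕ→ℚ (l C m) * p l)) + sum n (λ l → (- b) * (ℕ→ℚ (l C m) * q l))
    ≡⟨ cong₂ _+_ (sum-*ˡ n a (λ l → ℕ→ℚ (l C m) * p l)) (sum-*ˡ n (- b) (λ l → ℕ→ℚ (l C m) * q l)) ⟩
  a * shift n p m + (- b) * shift n q m
    ≡⟨ cong (_+_ (a * shift n p m)) (ℚₚ.neg-distribˡ-* b (shift n q m)) ⟨
  a * shift n p m - b * shift n q m ∎
  where
  open ≡-Reasoning
  distribute : ∀ c x y → c * (a * x - b * y) ≡ a * (c * x) + (- b) * (c * y)
  distribute c x y =
    solveℚ 5 (λ c x y a b → c :* (a :* x :- b :* y) := a :* (c :* x) :+ (:- b) :* (c :* y)) refl c x y a b

shift-mulX : ∀ n p m → shift (suc n) (mulX p) m ≡ mulX (shift n p) m + shift n p m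
shift-mulX n p m = begin
  ℕ→ℚ (0 C m) * 0ℚ + sum n (λ l → ℕ→ℚ (suc l C m) * p l)
    ≡⟨ trans (cong (_+ sum n (λ l → ℕ→ℚ (suc l C m) * p l)) (ℚₚ.*-zeroʳ (ℕ→ℚ (0 C m)))) (ℚₚ.+-identityˡ _) ⟩
  sum n (λ l → ℕ→ℚ (suc l C m) * p l)
    ≡⟨ pascal m ⟩
  mulX (shift n p) m + shift n p m ∎
  where
  open ≡-Reasoning
  pascal : ∀ m → sum n (λ l → ℕ→ℚ (suc l C m) * p l) ≡ mulX (shift n p) m + shift n p m
  pascal zero    = sym (ℚₚ.+-identityˡ _)
  pascal (suc m) = trans (sum-cong n (λ l _ → trans
      (cong (λ c → ℕ→ℚ c * p l) (sym (nCk+nC[k+1]≡[n+1]C[k+1] l m)))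
      (trans (cong (_* p l) (ℕ→ℚ-homo-+ (l C m) (l C suc m)))
             (ℚₚ.*-distribʳ-+ (p l) (ℕ→ℚ (l C m)) (ℕ→ℚ (l C suc m))))))
    (sum-+ n _ _)

shift-subleading : ∀ {n p} m → DegreeBelow (2 ℕ.+ m) p → 2 ℕ.+ m ≤ n →
                   shift n p m ≡ p m + ℕ→ℚ (suc m) * p (suc m)
shift-subleading {n} {p} m deg 2+m≤n = begin
  shift n p m
    ≡⟨ shift-extend deg 2+m≤n m ⟩
  sum (2 ℕ.+ m) term
    ≡⟨ sum-snoc (suc m) term ⟩
  sum (suc m) term + term (suc m)
    ≡⟨ cong (_+ term (suc m)) (sum-snoc m term) ⟩
  sum m term + term m + term (suc m)
    ≡⟨ cong (λ s → s + term m + term (suc m)) (sum-zeros m term below) ⟩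
  0ℚ + term m + term (suc m)
    ≡⟨ cong (_+ term (suc m)) (ℚₚ.+-identityˡ (term m)) ⟩
  ℕ→ℚ (m C m) * p m + ℕ→ℚ (suc m C m) * p (suc m)
    ≡⟨ cong₂ (λ a b → ℕ→ℚ a * p m + ℕ→ℚ b * p (suc m)) (nCn≡1 m) ([1+n]Cn≡1+n m) ⟩
  1ℚ * p m + ℕ→ℚ (suc m) * p (suc m)
    ≡⟨ cong (_+ ℕ→ℚ (suc m) * p (suc m)) (ℚₚ.*-identityˡ (p m)) ⟩
  p m + ℕ→ℚ (suc m) * p (suc m) ∎
  where
  open ≡-Reasoning
  term : ℕ → ℚ
  term l = ℕ→ℚ (l C m) * p l
  below : ∀ l → l < m → term l ≡ 0ℚ
  below l = k>n⇒nCk*q≡0 (p l)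

-- Downward induction: once the coefficients above x^(l+1) vanish, the coefficient of x^l
-- in p(x + 1) − p(x) is (l + 1) p_(l+1).
shift-invariant⇒constant : ∀ {n p} → DegreeBelow n p → (∀ m → suc m < n → shift n p m ≡ p m) →
                           ∀ l → p (suc l) ≡ 0ℚ
shift-invariant⇒constant {n} {p} deg invariant l = vanishes n l (ℕₚ.m≤n+m n (suc l))
  where
  vanishes : ∀ t l → n ≤ suc l ℕ.+ t → p (suc l) ≡ 0ℚ
  vanishes zero    l n≤ = deg (suc l) (subst (n ≤_) (ℕₚ.+-identityʳ (suc l)) n≤)
  vanishes (suc t) l n≤ with n ℕ.≤? suc l
  ... | yes n≤1+l = deg (suc l) n≤1+l
  ... | no  n≰1+l = ℕ→ℚ-suc-cancelˡ l (trans top-term (sym (ℚₚ.*-zeroʳ (ℕ→ℚ (suc l)))))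
    where
    2+l≤n : 2 ℕ.+ l ≤ n
    2+l≤n = ℕₚ.≰⇒> n≰1+l
    above : DegreeBelow (2 ℕ.+ l) p
    above (suc i) (s≤s 1+l≤i) = vanishes t i (ℕₚ.≤-trans n≤
      (subst (_≤ suc i ℕ.+ t) (sym (ℕₚ.+-suc (suc l) t)) (ℕₚ.+-monoˡ-≤ t (s≤s 1+l≤i))))
    top-term : ℕ→ℚ (suc l) * p (suc l) ≡ 0ℚ
    top-term = identityʳ-unique (p l) _ (trans (sym (shift-subleading l above 2+l≤n)) (invariant l 2+l≤n))

-- Falling factorials and Stirling numbers

S₁-vanishes : ∀ n j → n < j → S₁ n j ≡ + 0
S₁-vanishes zero    (suc j) n<j = refl
S₁-vanishes (suc n) (suc j) (s≤s n<j)
  rewrite S₁-vanishes n j n<j | S₁-vanishes n (suc j) (ℕₚ.m≤n⇒m≤1+n n<j) | ℤₚ.*-zeroʳ (+ n) = refl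

S₂-vanishes : ∀ k i → k < i → S₂ k i ≡ 0
S₂-vanishes zero    (suc i) k<i = refl
S₂-vanishes (suc k) (suc i) (s≤s k<i)
  rewrite S₂-vanishes k i k<i | S₂-vanishes k (suc i) (ℕₚ.m≤n⇒m≤1+n k<i) | ℕₚ.*-zeroʳ i = refl

-- The coefficients of the falling factorial x(x − 1)⋯(x − n + 1).
falling : ℕ → ℕ → ℚ
falling n j = ℤ→ℚ (S₁ n j)

S₂ℚ : ℕ → ℕ → ℚ
S₂ℚ k i = ℕ→ℚ (S₂ k i)

falling-degree : ∀ n → DegreeBelow (suc n) (falling n)
falling-degree n j n<j = cong ℤ→ℚ (S₁-vanishes n j n<j)

n*falling-n-0≡0 : ∀ n → ℕ→ℚ n * falling n 0 ≡ 0ℚ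
n*falling-n-0≡0 zero    = refl
n*falling-n-0≡0 (suc n) = ℚₚ.*-zeroʳ (ℕ→ℚ (suc n))

falling-suc : ∀ n m → falling (suc n) m ≡ mulX (falling n) m - ℕ→ℚ n * falling n m
falling-suc n zero    = sym (cong (_-_ 0ℚ) (n*falling-n-0≡0 n))
falling-suc n (suc m) = trans (ℤ→ℚ-homo-- (S₁ n m) (+ n ℤ.* S₁ n (suc m)))
  (cong (_-_ (falling n m)) (ℤ→ℚ-homo-* (+ n) (S₁ n (suc m))))

S₂ℚ-suc : ∀ k i → S₂ℚ (suc k) (suc i) ≡ ℕ→ℚ (suc i) * S₂ℚ k (suc i) + S₂ℚ k i
S₂ℚ-suc k i = trans (ℕ→ℚ-homo-+ (suc i ℕ.* S₂ k (suc i)) (S₂ k i))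
  (cong (_+ S₂ℚ k i) (ℕ→ℚ-homo-* (suc i) (S₂ k (suc i))))

-- Σ_i S₂(k, i) (x)_i = x^k.  The recurrences for S₂ and S₁ make the (m+1)-st coefficient
-- of level k + 1 equal to the m-th of level k plus a telescoping difference.
stirling-inversion : ∀ k N → k < N → ∀ m → sum N (λ i → S₂ℚ k i * falling i m) ≡ monomial k m
stirling-inversion zero (suc N) _ m = begin
  S₂ℚ 0 0 * falling 0 m + sum N (λ i → 0ℚ * falling (suc i) m)
    ≡⟨ cong (_+_ (S₂ℚ 0 0 * falling 0 m)) (sum-zeros N _ (λ i _ → ℚₚ.*-zeroˡ (falling (suc i) m))) ⟩
  S₂ℚ 0 0 * falling 0 m + 0ℚ
    ≡⟨ base m ⟩
  monomial 0 m ∎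
  where
  open ≡-Reasoning
  base : ∀ m → S₂ℚ 0 0 * falling 0 m + 0ℚ ≡ monomial 0 m
  base zero    = refl
  base (suc m) = refl
stirling-inversion (suc k) (suc N) _ zero =
  trans (ℚₚ.+-identityˡ _) (sum-zeros N _ (λ i _ → ℚₚ.*-zeroʳ (S₂ℚ (suc k) (suc i))))
stirling-inversion (suc k) (suc N) (s≤s k<N) (suc m) = begin
  S₂ℚ (suc k) 0 * falling 0 (suc m) + sum N (λ i → S₂ℚ (suc k) (suc i) * falling (suc i) (suc m))
    ≡⟨ ℚₚ.+-identityˡ _ ⟩
  sum N (λ i → S₂ℚ (suc k) (suc i) * falling (suc i) (suc m))
    ≡⟨ sum-cong N (λ i _ → recurrence i) ⟩
  sum N (λ i → S₂ℚ k i * falling i m + (a (suc i) - a i))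
    ≡⟨ sum-+ N _ _ ⟩
  sum N (λ i → S₂ℚ k i * falling i m) + sum N (λ i → a (suc i) - a i)
    ≡⟨ cong₂ _+_ (stirling-inversion k N k<N m) (sum-telescope N a) ⟩
  monomial k m + (a N - a 0)
    ≡⟨ cong (λ t → monomial k m + (t - a 0)) a-N ⟩
  monomial k m + (0ℚ - a 0)
    ≡⟨ cong (λ t → monomial k m + (0ℚ - t)) a-0 ⟩
  monomial k m + 0ℚ
    ≡⟨ ℚₚ.+-identityʳ (monomial k m) ⟩
  monomial k m ∎
  where
  open ≡-Reasoning
  a : ℕ → ℚ
  a i = ℕ→ℚ i * S₂ℚ k i * falling i (suc m)
  a-0 : a 0 ≡ 0ℚ
  a-0 = trans (cong (_* falling 0 (suc m)) (ℚₚ.*-zeroˡ (S₂ℚ k 0))) (ℚₚ.*-zeroˡ (falling 0 (suc m)))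
  a-N : a N ≡ 0ℚ
  a-N = trans (cong (λ s → ℕ→ℚ N * ℕ→ℚ s * falling N (suc m)) (S₂-vanishes k N k<N))
    (trans (cong (_* falling N (suc m)) (ℚₚ.*-zeroʳ (ℕ→ℚ N))) (ℚₚ.*-zeroˡ (falling N (suc m))))
  recurrence : ∀ i → S₂ℚ (suc k) (suc i) * falling (suc i) (suc m) ≡ S₂ℚ k i * falling i m + (a (suc i) - a i)
  recurrence i = begin
    S₂ℚ (suc k) (suc i) * falling (suc i) (suc m)
      ≡⟨ cong₂ _*_ (S₂ℚ-suc k i) (falling-suc i (suc m)) ⟩
    (ℕ→ℚ (suc i) * S₂ℚ k (suc i) + S₂ℚ k i) * (falling i m - ℕ→ℚ i * falling i (suc m))
      ≡⟨ solveℚ 6 (λ c s s′ f e f′ → (c :* s :+ s′) :* (f :- e :* f′)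
                                  := s′ :* f :+ (c :* s :* (f :- e :* f′) :- e :* s′ :* f′))
           refl (ℕ→ℚ (suc i)) (S₂ℚ k (suc i)) (S₂ℚ k i) (falling i m) (ℕ→ℚ i) (falling i (suc m)) ⟩
    S₂ℚ k i * falling i m + (ℕ→ℚ (suc i) * S₂ℚ k (suc i) * (falling i m - ℕ→ℚ i * falling i (suc m)) - a i)
      ≡⟨ cong (λ f → S₂ℚ k i * falling i m + (ℕ→ℚ (suc i) * S₂ℚ k (suc i) * f - a i)) (falling-suc i (suc m)) ⟨
    S₂ℚ k i * falling i m + (a (suc i) - a i) ∎

mulX-+ : ∀ p q m → mulX (λ l → p l + q l) m ≡ mulX p m + mulX q m
mulX-+ p q zero    = refl
mulX-+ p q (suc m) = refl

mulX-falling-suc : ∀ n m → mulX (falling (suc n)) m ≡ mulX (mulX (falling n)) m - ℕ→ℚ n * mulX (falling n) m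
mulX-falling-suc n zero    = sym (cong (_-_ 0ℚ) (ℚₚ.*-zeroʳ (ℕ→ℚ n)))
mulX-falling-suc n (suc m) = falling-suc n m

-- (x + 1)_(n+1) = (x + 1) (x)_n.
shift-falling : ∀ n m → shift (2 ℕ.+ n) (falling (suc n)) m ≡ mulX (falling n) m + falling n m
shift-falling zero zero          = refl
shift-falling zero (suc zero)    = refl
shift-falling zero (suc (suc m)) = refl
shift-falling (suc n) m = begin
  shift (3 ℕ.+ n) (falling (2 ℕ.+ n)) m
    ≡⟨ sum-cong (3 ℕ.+ n) (λ l _ → cong (ℕ→ℚ (l C m) *_) (as-combination l)) ⟩
  shift (3 ℕ.+ n) (λ l → 1ℚ * mulX F l - c * F l) m
    ≡⟨ shift-linear (3 ℕ.+ n) 1ℚ c (mulX F) F m ⟩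
  1ℚ * shift (3 ℕ.+ n) (mulX F) m - c * shift (3 ℕ.+ n) F m
    ≡⟨ cong₂ (λ u v → 1ℚ * u - c * v) (shift-mulX (2 ℕ.+ n) F m)
             (shift-extend (falling-degree (suc n)) (ℕₚ.n≤1+n _) m) ⟩
  1ℚ * (mulX (shift (2 ℕ.+ n) F) m + shift (2 ℕ.+ n) F m) - c * shift (2 ℕ.+ n) F m
    ≡⟨ cong₂ (λ u v → 1ℚ * (u + v) - c * v)
             (trans (mulX-cong (shift-falling n) m) (mulX-+ (mulX f) f m)) (shift-falling n m) ⟩
  1ℚ * ((mulX (mulX f) m + mulX f m) + (mulX f m + f m)) - c * (mulX f m + f m)
    ≡⟨ cong (λ d → 1ℚ * ((mulX (mulX f) m + mulX f m) + (mulX f m + f m)) - d * (mulX f m + f m))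
            (ℕ→ℚ-homo-+ 1 n) ⟩
  1ℚ * ((mulX (mulX f) m + mulX f m) + (mulX f m + f m)) - (1ℚ + ℕ→ℚ n) * (mulX f m + f m)
    ≡⟨ solveℚ 4 (λ xx x y d → con 1ℚ :* ((xx :+ x) :+ (x :+ y)) :- (con 1ℚ :+ d) :* (x :+ y)
                            := (xx :- d :* x) :+ (x :- d :* y))
         refl (mulX (mulX f) m) (mulX f m) (f m) (ℕ→ℚ n) ⟩
  (mulX (mulX f) m - ℕ→ℚ n * mulX f m) + (mulX f m - ℕ→ℚ n * f m)
    ≡⟨ cong₂ _+_ (mulX-falling-suc n m) (falling-suc n m) ⟨
  mulX F m + F m ∎
  where
  open ≡-Reasoning
  f F : ℕ → ℚ
  f = falling n
  F = falling (suc n)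
  c : ℚ
  c = ℕ→ℚ (suc n)
  as-combination : ∀ l → falling (2 ℕ.+ n) l ≡ 1ℚ * mulX F l - c * F l
  as-combination l = trans (falling-suc (suc n) l) (cong (_- c * F l) (sym (ℚₚ.*-identityˡ (mulX F l))))

shift-falling-suc : ∀ {N} n m → 2 ℕ.+ n ≤ N →
                    shift N (falling (suc n)) m ≡ falling (suc n) m + ℕ→ℚ (suc n) * falling n m
shift-falling-suc {N} n m 2+n≤N = begin
  shift N (falling (suc n)) m
    ≡⟨ shift-extend (falling-degree (suc n)) 2+n≤N m ⟩
  shift (2 ℕ.+ n) (falling (suc n)) m
    ≡⟨ shift-falling n m ⟩
  mulX (falling n) m + falling n m
    ≡⟨ solveℚ 3 (λ x y d → x :+ y := (x :- d :* y) :+ (con 1ℚ :+ d) :* y)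
         refl (mulX (falling n) m) (falling n m) (ℕ→ℚ n) ⟩
  (mulX (falling n) m - ℕ→ℚ n * falling n m) + (1ℚ + ℕ→ℚ n) * falling n m
    ≡⟨ cong₂ (λ u d → u + d * falling n m) (falling-suc n m) (ℕ→ℚ-homo-+ 1 n) ⟨
  falling (suc n) m + ℕ→ℚ (suc n) * falling n m ∎
  where open ≡-Reasoning

-- The coefficients of Σ_i S₂(k, i) (x)_(i+1) / (i + 1), the polynomial P with
-- P(x + 1) − P(x) = x^k and P(0) = 0.
powerSum : ℕ → ℕ → ℚ
powerSum k l = sum (suc k) (λ i → S₂ℚ k i * falling (suc i) l * 1/suc i)

powerSum-degree : ∀ k → DegreeBelow (2 ℕ.+ k) (powerSum k)
powerSum-degree k l 2+k≤l = sum-zeros (suc k) _ (λ i i≤k → begin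
  S₂ℚ k i * falling (suc i) l * 1/suc i
    ≡⟨ cong (λ f → S₂ℚ k i * f * 1/suc i) (falling-degree (suc i) l (ℕₚ.≤-trans (s≤s i≤k) 2+k≤l)) ⟩
  S₂ℚ k i * 0ℚ * 1/suc i
    ≡⟨ cong (_* 1/suc i) (ℚₚ.*-zeroʳ (S₂ℚ k i)) ⟩
  0ℚ * 1/suc i
    ≡⟨ ℚₚ.*-zeroˡ (1/suc i) ⟩
  0ℚ ∎)
  where open ≡-Reasoning

shift-powerSum : ∀ k m → shift (2 ℕ.+ k) (powerSum k) m ≡ powerSum k m + monomial k m
shift-powerSum k m = begin
  sum K (λ l → ℕ→ℚ (l C m) * powerSum k l)
    ≡⟨ sum-cong K (λ l _ → pull-inside l) ⟩
  sum K (λ l → sum (suc k) (λ i → weight i * (ℕ→ℚ (l C m) * falling (suc i) l)))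
    ≡⟨ sum-swap K (suc k) (λ l i → weight i * (ℕ→ℚ (l C m) * falling (suc i) l)) ⟩
  sum (suc k) (λ i → sum K (λ l → weight i * (ℕ→ℚ (l C m) * falling (suc i) l)))
    ≡⟨ sum-cong (suc k) (λ i i≤k → trans (sum-*ˡ K (weight i) (λ l → ℕ→ℚ (l C m) * falling (suc i) l))
                                         (cong (weight i *_) (shift-falling-suc i m (s≤s i≤k)))) ⟩
  sum (suc k) (λ i → weight i * (falling (suc i) m + ℕ→ℚ (suc i) * falling i m))
    ≡⟨ sum-cong (suc k) (λ i _ → expand i) ⟩
  sum (suc k) (λ i → S₂ℚ k i * falling (suc i) m * 1/suc i + S₂ℚ k i * falling i m)
    ≡⟨ sum-+ (suc k) (λ i → S₂ℚ k i * falling (suc i) m * 1/suc i) (λ i → S₂ℚ k i * falling i m) ⟩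
  powerSum k m + sum (suc k) (λ i → S₂ℚ k i * falling i m)
    ≡⟨ cong (_+_ (powerSum k m)) (stirling-inversion k (suc k) (ℕₚ.n<1+n k) m) ⟩
  powerSum k m + monomial k m ∎
  where
  open ≡-Reasoning
  K : ℕ
  K = 2 ℕ.+ k
  weight : ℕ → ℚ
  weight i = S₂ℚ k i * 1/suc i
  pull-inside : ∀ l → ℕ→ℚ (l C m) * powerSum k l ≡
                      sum (suc k) (λ i → weight i * (ℕ→ℚ (l C m) * falling (suc i) l))
  pull-inside l = trans (sym (sum-*ˡ (suc k) (ℕ→ℚ (l C m)) (λ i → S₂ℚ k i * falling (suc i) l * 1/suc i)))
    (sum-cong (suc k) (λ i _ → solveℚ 4 (λ c s f v → c :* (s :* f :* v) := (s :* v) :* (c :* f))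
                                  refl (ℕ→ℚ (l C m)) (S₂ℚ k i) (falling (suc i) l) (1/suc i)))
  expand : ∀ i → weight i * (falling (suc i) m + ℕ→ℚ (suc i) * falling i m) ≡
                 S₂ℚ k i * falling (suc i) m * 1/suc i + S₂ℚ k i * falling i m
  expand i = begin
    weight i * (falling (suc i) m + ℕ→ℚ (suc i) * falling i m)
      ≡⟨ solveℚ 5 (λ s v f d g → (s :* v) :* (f :+ d :* g) := s :* f :* v :+ s :* (v :* d) :* g)
           refl (S₂ℚ k i) (1/suc i) (falling (suc i) m) (ℕ→ℚ (suc i)) (falling i m) ⟩
    S₂ℚ k i * falling (suc i) m * 1/suc i + S₂ℚ k i * (1/suc i * ℕ→ℚ (suc i)) * falling i m
      ≡⟨ cong (λ u → S₂ℚ k i * falling (suc i) m * 1/suc i + S₂ℚ k i * u * falling i m) (1/suc-inverseˡ i) ⟩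
    S₂ℚ k i * falling (suc i) m * 1/suc i + S₂ℚ k i * 1ℚ * falling i m
      ≡⟨ cong (λ u → S₂ℚ k i * falling (suc i) m * 1/suc i + u * falling i m) (ℚₚ.*-identityʳ (S₂ℚ k i)) ⟩
    S₂ℚ k i * falling (suc i) m * 1/suc i + S₂ℚ k i * falling i m ∎

-- Bernoulli numbers and polynomials

-- The accumulator of bernTable is local to its where-block and cannot be named;
-- unification recovers it, after abstracting the arguments it is applied to.
mutual
  tableAcc : ℕ → ℕ → List ℚ → ℚ
  tableAcc n = _

  bern-suc : ∀ n → bern (suc n) ≡ - (1/suc (suc n) * tableAcc n 0 (bernTable n))
  bern-suc n with 1/suc (suc n) | bernTable n
  ... | _ | _ with 0
  ... | _ = refl

tableAcc≡sum : ∀ n r p →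
  tableAcc n p (bernTable r) ≡ sum (suc r) (λ m → ℕ→ℚ (suc (suc n) C (n ℕ.∸ (p ℕ.+ (r ℕ.∸ m)))) * bern m)
tableAcc≡sum n zero    p = cong (λ q → ℕ→ℚ (suc (suc n) C (n ℕ.∸ q)) * 1ℚ + 0ℚ) (sym (ℕₚ.+-identityʳ p))
tableAcc≡sum n (suc r) p = begin
  term p (suc r) + tableAcc n (suc p) (bernTable r)
    ≡⟨ cong (_+_ (term p (suc r))) (tableAcc≡sum n r (suc p)) ⟩
  term p (suc r) + sum (suc r) (λ m → term (suc p ℕ.+ (r ℕ.∸ m)) m)
    ≡⟨ ℚₚ.+-comm (term p (suc r)) _ ⟩
  sum (suc r) (λ m → term (suc p ℕ.+ (r ℕ.∸ m)) m) + term p (suc r)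
    ≡⟨ cong₂ _+_ (sum-cong (suc r) (λ m m≤r → cong (λ q → term q m) (index m (ℕₚ.≤-pred m≤r))))
                 (cong (λ q → term q (suc r))
                       (trans (sym (ℕₚ.+-identityʳ p)) (cong (p ℕ.+_) (sym (ℕₚ.n∸n≡0 r))))) ⟩
  sum (suc r) (λ m → term (p ℕ.+ (suc r ℕ.∸ m)) m) + term (p ℕ.+ (suc r ℕ.∸ suc r)) (suc r)
    ≡⟨ sum-snoc (suc r) (λ m → term (p ℕ.+ (suc r ℕ.∸ m)) m) ⟨
  sum (2 ℕ.+ r) (λ m → term (p ℕ.+ (suc r ℕ.∸ m)) m) ∎
  where
  open ≡-Reasoning
  term : ℕ → ℕ → ℚ
  term q m = ℕ→ℚ (suc (suc n) C (n ℕ.∸ q)) * bern m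
  index : ∀ m → m ≤ r → suc p ℕ.+ (r ℕ.∸ m) ≡ p ℕ.+ (suc r ℕ.∸ m)
  index m m≤r = trans (sym (ℕₚ.+-suc p (r ℕ.∸ m))) (cong (p ℕ.+_) (sym (ℕₚ.+-∸-assoc 1 m≤r)))

bernoulli-recurrence : ∀ n → sum n (λ m → ℕ→ℚ (n C m) * bern m) ≡ monomial 1 n
bernoulli-recurrence zero          = refl
bernoulli-recurrence (suc zero)    = refl
bernoulli-recurrence (suc (suc n)) = begin
  sum (2 ℕ.+ n) (λ m → ℕ→ℚ (suc (suc n) C m) * bern m)
    ≡⟨ sum-snoc (suc n) (λ m → ℕ→ℚ (suc (suc n) C m) * bern m) ⟩
  X + ℕ→ℚ (suc (suc n) C suc n) * bern (suc n)
    ≡⟨ cong₂ (λ c b → X + ℕ→ℚ c * b) ([1+n]Cn≡1+n (suc n)) (bern-suc n) ⟩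
  X + ℕ→ℚ (2 ℕ.+ n) * - (1/suc (suc n) * tableAcc n 0 (bernTable n))
    ≡⟨ cong (λ t → X + ℕ→ℚ (2 ℕ.+ n) * - (1/suc (suc n) * t)) table-is-X ⟩
  X + ℕ→ℚ (2 ℕ.+ n) * - (1/suc (suc n) * X)
    ≡⟨ solveℚ 3 (λ x d v → x :+ d :* (:- (v :* x)) := x :- (v :* d) :* x)
         refl X (ℕ→ℚ (2 ℕ.+ n)) (1/suc (suc n)) ⟩
  X - 1/suc (suc n) * ℕ→ℚ (2 ℕ.+ n) * X
    ≡⟨ cong (λ u → X - u * X) (1/suc-inverseˡ (suc n)) ⟩
  X - 1ℚ * X
    ≡⟨ cong (_-_ X) (ℚₚ.*-identityˡ X) ⟩
  X - X
    ≡⟨ ℚₚ.+-inverseʳ X ⟩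
  0ℚ ∎
  where
  open ≡-Reasoning
  X : ℚ
  X = sum (suc n) (λ m → ℕ→ℚ (suc (suc n) C m) * bern m)
  table-is-X : tableAcc n 0 (bernTable n) ≡ X
  table-is-X = trans (tableAcc≡sum n n 0) (sum-cong (suc n) (λ m m≤n →
    cong (λ c → ℕ→ℚ (suc (suc n) C c) * bern m) (ℕₚ.m∸[m∸n]≡n (ℕₚ.≤-pred m≤n))))

bernCoeff : ℕ → ℕ → ℚ
bernCoeff n l = ℕ→ℚ (n C l) * bern (n ℕ.∸ l)

bernCoeff-degree : ∀ n → DegreeBelow (suc n) (bernCoeff n)
bernCoeff-degree n l n<l = k>n⇒nCk*q≡0 (bern (n ℕ.∸ l)) n<l

bernoulli-at-one : ∀ n → sum (suc n) (bernCoeff n) ≡ bern n + monomial 1 n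
bernoulli-at-one n = begin
  sum (suc n) (bernCoeff n)
    ≡⟨ sum-reverse n (bernCoeff n) ⟩
  sum (suc n) (λ r → bernCoeff n (n ℕ.∸ r))
    ≡⟨ sum-cong (suc n) (λ r r≤n → reflect (ℕₚ.≤-pred r≤n)) ⟩
  sum (suc n) (λ s → ℕ→ℚ (n C s) * bern s)
    ≡⟨ sum-snoc n (λ s → ℕ→ℚ (n C s) * bern s) ⟩
  sum n (λ s → ℕ→ℚ (n C s) * bern s) + ℕ→ℚ (n C n) * bern n
    ≡⟨ cong₂ (λ u c → u + ℕ→ℚ c * bern n) (bernoulli-recurrence n) (nCn≡1 n) ⟩
  monomial 1 n + 1ℚ * bern n
    ≡⟨ cong (_+_ (monomial 1 n)) (ℚₚ.*-identityˡ (bern n)) ⟩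
  monomial 1 n + bern n
    ≡⟨ ℚₚ.+-comm (monomial 1 n) (bern n) ⟩
  bern n + monomial 1 n ∎
  where
  open ≡-Reasoning
  reflect : ∀ {r} → r ≤ n → bernCoeff n (n ℕ.∸ r) ≡ ℕ→ℚ (n C r) * bern r
  reflect r≤n = cong₂ (λ c s → ℕ→ℚ c * bern s) (sym (nCk≡nC[n∸k] r≤n)) (ℕₚ.m∸[m∸n]≡n r≤n)

monomial-∸ : ∀ k m → m ≤ k → monomial 0 (k ℕ.∸ m) ≡ monomial k m
monomial-∸ zero    zero    _         = refl
monomial-∸ (suc k) zero    _         = refl
monomial-∸ (suc k) (suc m) (s≤s m≤k) = monomial-∸ k m m≤k

-- B_(k+1)(x + 1) = B_(k+1)(x) + (k + 1) x^k.
shift-bernCoeff : ∀ k m → m ≤ k →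
                  shift (2 ℕ.+ k) (bernCoeff (suc k)) m ≡ bernCoeff (suc k) m + ℕ→ℚ (suc k) * monomial k m
shift-bernCoeff k m m≤k = begin
  sum (2 ℕ.+ k) term
    ≡⟨ cong (λ N → sum N term) split-point ⟩
  sum (m ℕ.+ (2 ℕ.+ r)) term
    ≡⟨ sum-split m (2 ℕ.+ r) term ⟩
  sum m term + sum (2 ℕ.+ r) (λ t → term (m ℕ.+ t))
    ≡⟨ cong₂ _+_ (sum-zeros m term (λ l l<m → k>n⇒nCk*q≡0 (bernCoeff (suc k) l) l<m))
                 (sum-cong (2 ℕ.+ r) (λ t t≤1+r → revision t (ℕₚ.≤-pred t≤1+r))) ⟩
  0ℚ + sum (2 ℕ.+ r) (λ t → c * bernCoeff (suc r) t)
    ≡⟨ trans (ℚₚ.+-identityˡ _) (sum-*ˡ (2 ℕ.+ r) c (bernCoeff (suc r))) ⟩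
  c * sum (2 ℕ.+ r) (bernCoeff (suc r))
    ≡⟨ cong (c *_) (bernoulli-at-one (suc r)) ⟩
  c * (bern (suc r) + monomial 0 r)
    ≡⟨ ℚₚ.*-distribˡ-+ c (bern (suc r)) (monomial 0 r) ⟩
  c * bern (suc r) + c * monomial 0 r
    ≡⟨ cong₂ (λ s u → c * bern s + c * u) (sym 1+k∸m≡1+r) (monomial-∸ k m m≤k) ⟩
  bernCoeff (suc k) m + c * monomial k m
    ≡⟨ cong (_+_ (bernCoeff (suc k) m)) (*-monomial (λ i → ℕ→ℚ (suc k C i)) k m) ⟨
  bernCoeff (suc k) m + ℕ→ℚ (suc k C k) * monomial k m
    ≡⟨ cong (λ d → bernCoeff (suc k) m + ℕ→ℚ d * monomial k m) ([1+n]Cn≡1+n k) ⟩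
  bernCoeff (suc k) m + ℕ→ℚ (suc k) * monomial k m ∎
  where
  open ≡-Reasoning
  r : ℕ
  r = k ℕ.∸ m
  c : ℚ
  c = ℕ→ℚ (suc k C m)
  term : ℕ → ℚ
  term l = ℕ→ℚ (l C m) * bernCoeff (suc k) l
  1+k∸m≡1+r : suc k ℕ.∸ m ≡ suc r
  1+k∸m≡1+r = ℕₚ.+-∸-assoc 1 m≤k
  m+[1+r]≡1+k : m ℕ.+ suc r ≡ suc k
  m+[1+r]≡1+k = trans (ℕₚ.+-suc m r) (cong suc (ℕₚ.m+[n∸m]≡n m≤k))
  split-point : 2 ℕ.+ k ≡ m ℕ.+ (2 ℕ.+ r)
  split-point = sym (trans (ℕₚ.+-suc m (suc r)) (cong suc m+[1+r]≡1+k))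
  revision : ∀ t → t ≤ suc r → term (m ℕ.+ t) ≡ c * bernCoeff (suc r) t
  revision t t≤1+r = begin
    ℕ→ℚ ((m ℕ.+ t) C m) * (ℕ→ℚ (suc k C (m ℕ.+ t)) * bern (suc k ℕ.∸ (m ℕ.+ t)))
      ≡⟨ solveℚ 3 (λ a b x → a :* (b :* x) := (b :* a) :* x)
           refl (ℕ→ℚ ((m ℕ.+ t) C m)) (ℕ→ℚ (suc k C (m ℕ.+ t))) (bern (suc k ℕ.∸ (m ℕ.+ t))) ⟩
    (ℕ→ℚ (suc k C (m ℕ.+ t)) * ℕ→ℚ ((m ℕ.+ t) C m)) * bern (suc k ℕ.∸ (m ℕ.+ t))
      ≡⟨ cong₂ _*_ binomials (cong bern index) ⟩
    (c * ℕ→ℚ (suc r C t)) * bern (suc r ℕ.∸ t)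
      ≡⟨ ℚₚ.*-assoc c (ℕ→ℚ (suc r C t)) (bern (suc r ℕ.∸ t)) ⟩
    c * bernCoeff (suc r) t ∎
    where
    m+t≤1+k : m ℕ.+ t ≤ suc k
    m+t≤1+k = ℕₚ.≤-trans (ℕₚ.+-monoʳ-≤ m t≤1+r) (ℕₚ.≤-reflexive m+[1+r]≡1+k)
    binomials : ℕ→ℚ (suc k C (m ℕ.+ t)) * ℕ→ℚ ((m ℕ.+ t) C m) ≡ c * ℕ→ℚ (suc r C t)
    binomials = begin
      ℕ→ℚ (suc k C (m ℕ.+ t)) * ℕ→ℚ ((m ℕ.+ t) C m)
        ≡⟨ ℕ→ℚ-homo-* (suc k C (m ℕ.+ t)) ((m ℕ.+ t) C m) ⟨
      ℕ→ℚ ((suc k C (m ℕ.+ t)) ℕ.* ((m ℕ.+ t) C m))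
        ≡⟨ cong ℕ→ℚ (nCl*lCm≡nCm*[n∸m]C[l∸m] (ℕₚ.m≤m+n m t) m+t≤1+k) ⟩
      ℕ→ℚ ((suc k C m) ℕ.* ((suc k ℕ.∸ m) C (m ℕ.+ t ℕ.∸ m)))
        ≡⟨ cong₂ (λ a b → ℕ→ℚ ((suc k C m) ℕ.* (a C b))) 1+k∸m≡1+r (ℕₚ.m+n∸m≡n m t) ⟩
      ℕ→ℚ ((suc k C m) ℕ.* (suc r C t))
        ≡⟨ ℕ→ℚ-homo-* (suc k C m) (suc r C t) ⟩
      c * ℕ→ℚ (suc r C t) ∎
    index : suc k ℕ.∸ (m ℕ.+ t) ≡ suc r ℕ.∸ t
    index = trans (sym (ℕₚ.∸-+-assoc (suc k) m t)) (cong (ℕ._∸ t) 1+k∸m≡1+r)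

-- (k + 1) · powerSum k and B_(k+1) differ by a polynomial invariant under x ↦ x + 1,
-- hence agree in all non-constant coefficients.
powerSum-coefficient : ∀ k j → ℕ→ℚ (suc j) * powerSum k (suc j) ≡ bernCoeff k j
powerSum-coefficient k j = ℕ→ℚ-suc-cancelˡ k (begin
  ℕ→ℚ (suc k) * (ℕ→ℚ (suc j) * powerSum k (suc j))
    ≡⟨ solveℚ 3 (λ a b x → a :* (b :* x) := b :* (a :* x))
         refl (ℕ→ℚ (suc k)) (ℕ→ℚ (suc j)) (powerSum k (suc j)) ⟩
  ℕ→ℚ (suc j) * (ℕ→ℚ (suc k) * powerSum k (suc j))
    ≡⟨ cong (ℕ→ℚ (suc j) *_) (same-coefficient j) ⟩
  ℕ→ℚ (suc j) * (ℕ→ℚ (suc k C suc j) * bern (k ℕ.∸ j))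
    ≡⟨ ℚₚ.*-assoc (ℕ→ℚ (suc j)) _ _ ⟨
  ℕ→ℚ (suc j) * ℕ→ℚ (suc k C suc j) * bern (k ℕ.∸ j)
    ≡⟨ cong (_* bern (k ℕ.∸ j)) absorption ⟩
  ℕ→ℚ (suc k) * ℕ→ℚ (k C j) * bern (k ℕ.∸ j)
    ≡⟨ ℚₚ.*-assoc (ℕ→ℚ (suc k)) _ _ ⟩
  ℕ→ℚ (suc k) * bernCoeff k j ∎)
  where
  open ≡-Reasoning
  difference : ℕ → ℚ
  difference l = ℕ→ℚ (suc k) * powerSum k l - 1ℚ * bernCoeff (suc k) l
  difference-degree : DegreeBelow (2 ℕ.+ k) difference
  difference-degree l 2+k≤l = begin
    ℕ→ℚ (suc k) * powerSum k l - 1ℚ * bernCoeff (suc k) l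
      ≡⟨ cong₂ (λ u v → ℕ→ℚ (suc k) * u - 1ℚ * v)
               (powerSum-degree k l 2+k≤l) (bernCoeff-degree (suc k) l 2+k≤l) ⟩
    ℕ→ℚ (suc k) * 0ℚ - 1ℚ * 0ℚ
      ≡⟨ cong (_- 1ℚ * 0ℚ) (ℚₚ.*-zeroʳ (ℕ→ℚ (suc k))) ⟩
    0ℚ ∎
  difference-invariant : ∀ m → suc m < 2 ℕ.+ k → shift (2 ℕ.+ k) difference m ≡ difference m
  difference-invariant m (s≤s (s≤s m≤k)) = begin
    shift (2 ℕ.+ k) difference m
      ≡⟨ shift-linear (2 ℕ.+ k) (ℕ→ℚ (suc k)) 1ℚ (powerSum k) (bernCoeff (suc k)) m ⟩
    ℕ→ℚ (suc k) * shift (2 ℕ.+ k) (powerSum k) m - 1ℚ * shift (2 ℕ.+ k) (bernCoeff (suc k)) m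
      ≡⟨ cong₂ (λ u v → ℕ→ℚ (suc k) * u - 1ℚ * v) (shift-powerSum k m) (shift-bernCoeff k m m≤k) ⟩
    ℕ→ℚ (suc k) * (powerSum k m + monomial k m) - 1ℚ * (bernCoeff (suc k) m + ℕ→ℚ (suc k) * monomial k m)
      ≡⟨ solveℚ 4 (λ a g δ b → a :* (g :+ δ) :- con 1ℚ :* (b :+ a :* δ) := a :* g :- con 1ℚ :* b)
           refl (ℕ→ℚ (suc k)) (powerSum k m) (monomial k m) (bernCoeff (suc k) m) ⟩
    difference m ∎
  same-coefficient : ∀ l → ℕ→ℚ (suc k) * powerSum k (suc l) ≡ bernCoeff (suc k) (suc l)
  same-coefficient l = begin
    ℕ→ℚ (suc k) * powerSum k (suc l)
      ≡⟨ solveℚ 2 (λ a b → a := (a :- con 1ℚ :* b) :+ b)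
           refl (ℕ→ℚ (suc k) * powerSum k (suc l)) (bernCoeff (suc k) (suc l)) ⟩
    difference (suc l) + bernCoeff (suc k) (suc l)
      ≡⟨ cong (_+ bernCoeff (suc k) (suc l)) (shift-invariant⇒constant difference-degree difference-invariant l) ⟩
    0ℚ + bernCoeff (suc k) (suc l)
      ≡⟨ ℚₚ.+-identityˡ _ ⟩
    bernCoeff (suc k) (suc l) ∎
  absorption : ℕ→ℚ (suc j) * ℕ→ℚ (suc k C suc j) ≡ ℕ→ℚ (suc k) * ℕ→ℚ (k C j)
  absorption = begin
    ℕ→ℚ (suc j) * ℕ→ℚ (suc k C suc j)   ≡⟨ ℕ→ℚ-homo-* (suc j) (suc k C suc j) ⟨
    ℕ→ℚ (suc j ℕ.* (suc k C suc j))     ≡⟨ cong ℕ→ℚ ([1+k]*[1+n]C[1+k]≡[1+n]*nCk k j) ⟩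
    ℕ→ℚ (suc k ℕ.* (k C j))             ≡⟨ ℕ→ℚ-homo-* (suc k) (k C j) ⟩
    ℕ→ℚ (suc k) * ℕ→ℚ (k C j)           ∎

summand : ℕ → ℚ → ℕ → ℕ → ℚ
summand k x j i = ((+ (suc j)) / (suc i)) * ℤ→ℚ (S₁ (suc i) (suc j)) * ℕ→ℚ (S₂ k i) * (x ^ j)

Σ-summand : ∀ k x j → j ≤ k → Σ[ j to k ] (summand k x j) ≡ bernCoeff k j * (x ^ j)
Σ-summand k x j j≤k = begin
  Σ[ j to k ] (summand k x j)
    ≡⟨ Σ≡sum j k (summand k x j) j≤k below ⟩
  sum (suc k) (summand k x j)
    ≡⟨ sum-cong (suc k) (λ i _ → regroup i) ⟩
  sum (suc k) (λ i → (x ^ j * ℕ→ℚ (suc j)) * (S₂ℚ k i * falling (suc i) (suc j) * 1/suc i))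
    ≡⟨ sum-*ˡ (suc k) (x ^ j * ℕ→ℚ (suc j)) (λ i → S₂ℚ k i * falling (suc i) (suc j) * 1/suc i) ⟩
  (x ^ j * ℕ→ℚ (suc j)) * powerSum k (suc j)
    ≡⟨ solveℚ 3 (λ y a g → (y :* a) :* g := (a :* g) :* y) refl (x ^ j) (ℕ→ℚ (suc j)) (powerSum k (suc j)) ⟩
  (ℕ→ℚ (suc j) * powerSum k (suc j)) * (x ^ j)
    ≡⟨ cong (_* (x ^ j)) (powerSum-coefficient k j) ⟩
  bernCoeff k j * (x ^ j) ∎
  where
  open ≡-Reasoning
  below : ∀ i → i < j → summand k x j i ≡ 0ℚ
  below i i<j = begin
    ((+ (suc j)) / (suc i)) * falling (suc i) (suc j) * S₂ℚ k i * (x ^ j)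
      ≡⟨ cong (λ f → ((+ (suc j)) / (suc i)) * f * S₂ℚ k i * (x ^ j))
              (falling-degree (suc i) (suc j) (s≤s i<j)) ⟩
    ((+ (suc j)) / (suc i)) * 0ℚ * S₂ℚ k i * (x ^ j)
      ≡⟨ solveℚ 3 (λ a b c → a :* con 0ℚ :* b :* c := con 0ℚ) refl ((+ (suc j)) / (suc i)) (S₂ℚ k i) (x ^ j) ⟩
    0ℚ ∎
  regroup : ∀ i → summand k x j i ≡ (x ^ j * ℕ→ℚ (suc j)) * (S₂ℚ k i * falling (suc i) (suc j) * 1/suc i)
  regroup i = trans (cong (λ q → q * falling (suc i) (suc j) * S₂ℚ k i * (x ^ j)) (/suc≡*1/suc (suc j) i))
    (solveℚ 5 (λ a v f s y → a :* v :* f :* s :* y := (y :* a) :* (s :* f :* v)) refl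
      (ℕ→ℚ (suc j)) (1/suc i) (falling (suc i) (suc j)) (S₂ℚ k i) (x ^ j))

mainTheorem2 : (k : ℕ) (x : ℚ) →
    bernPoly k x ≡
      Σ[ 0 to k ] (λ j → Σ[ j to k ] (λ i →
        ((+ (suc j)) / (suc i)) * ℤ→ℚ (S₁ (suc i) (suc j)) * ℕ→ℚ (S₂ k i) * (x ^ j)))
mainTheorem2 k x = begin
  bernPoly k x
    ≡⟨ Σ≡sum 0 k (λ j → bernCoeff k j * (x ^ j)) z≤n (λ _ ()) ⟩
  sum (suc k) (λ j → bernCoeff k j * (x ^ j))
    ≡⟨ sum-cong (suc k) (λ j j≤k → Σ-summand k x j (ℕₚ.≤-pred j≤k)) ⟨
  sum (suc k) (λ j → Σ[ j to k ] (summand k x j))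
    ≡⟨ Σ≡sum 0 k (λ j → Σ[ j to k ] (summand k x j)) z≤n (λ _ ()) ⟨
  Σ[ 0 to k ] (λ j → Σ[ j to k ] (summand k x j)) ∎
  where open ≡-Reasoning
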